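{- Let $\alpha$ be a finite set and let $B$ be a building set of $P(\alpha)$ with $\alpha\in B$. Then \[\mathcal N(P(\alpha),B)=\widetilde{\mathcal N}(P(\alpha)-\{\alpha\},B-\{\alpha\}).\]
   Context: A simplicial complex is a set $C=P(\alpha_1)\cup\ldots\cup P(\alpha_m)$, $m\ge1$, with $P(\cdot)$ the power set and the $\alpha_i$ finite pairwise $\subseteq$-incomparable sets (bases). For a family $B$ and set $\beta$, $B_\beta=B\cap P(\beta)$. A building set of $P(\gamma)$ ($\gamma$ finite) is a set $B$ of nonempty subsets of $\gamma$ with (B1) $\beta,\delta\in B$, $\beta\cap\delta\ne\emptyset$ imply $\beta\cup\delta\in B$, (B2) $\{a\}\in B$ for $a\in\gamma$. A building set of a simplicial complex $C$ with bases $\alpha_i$ is $B\subseteq C$ with every $B_{\alpha_i}$ a building set of $P(\alpha_i)$. An $N$-antichain is a set of at least two pairwise $\subseteq$-incomparable members of $N$. For $B$ a building set of $C$, $N\subseteq B$ is nested if for every $N$-antichain $\{\beta_1,\ldots,\beta_t\}$, $\beta_1\cup\ldots\cup\beta_t\in C-B$; $\widetilde{\mathcal N}(C,B)$ is the simplicial complex of all nested subsets of $B$. (In particular, for $C=P(\alpha)$, $N\in\widetilde{\mathcal N}(P(\alpha),B)$ iff $N\subseteq B$ and every $N$-antichain has union not in $B$.) For $B$ a building set of $P(\alpha)$ containing $\alpha$, $\mathcal N(P(\alpha),B)$ is the link of $\alpha$ in $\widetilde{\mathcal N}(P(\alpha),B)$, i.e. the set of all $N\in\widetilde{\mathcal N}(P(\alpha),B)$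 with $\alpha\notin N$ and $N\cup\{\alpha\}\in\widetilde{\mathcal N}(P(\alpha),B)$. For nonempty $\alpha$, $P(\alpha)-\{\alpha\}$ is the simplicial complex with bases $\alpha-\{a\}$, $a\in\alpha$. -}

module Defs where

open import Level using (0ℓ)
open import Data.Nat using (ℕ; _≤_)
open import Data.Unit using (⊤; tt)
open import Data.Empty using (⊥)
open import Data.Sum using (_⊎_)
open import Data.Product using (Σ; ∃; _×_)
open import Data.List using (List; foldr; length)
open import Data.List.Relation.Unary.All using (All)
open import Data.List.Relation.Unary.AllPairs using (AllPairs)
open import Data.Fin using (Fin)
open import Data.Fin.Subset using (Subset; _∈_; _⊆_; _⊈_; _∪_; _∩_; _-_; ⁅_⁆; Nonempty)
open import Relation.Nullary using (¬_)
open import Relation.Binary.PropositionalEquality using (_≡_)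
open import Relation.Unary using (Pred)
import Data.Fin.Subset as S

Family : ℕ → Set₁
Family n = Pred (Subset n) 0ℓ

complexFromBases : ∀ {n} {I : Set} → (I → Subset n) → Family n
complexFromBases {I = I} base β = Σ I (λ i → β ⊆ base i)

PowerSet : ∀ {n} → Subset n → Family n
PowerSet α = complexFromBases {I = ⊤} (λ _ → α)

-- P(α) - {α}: the complex with bases α - {a}, a ∈ α.
PowerSetMinusTop : ∀ {n} → Subset n → Family n
PowerSetMinusTop {n} α =
  complexFromBases {I = Σ (Fin n) (λ a → a ∈ α)} (λ p → α - Data.Product.proj₁ p)

_without_ : ∀ {n} → Family n → Subset n → Family n
(B without α) β = B β × ¬ (β ≡ α)

_with+_ : ∀ {n} → Family n → Subset n → Family n
(N with+ α) β = N β ⊎ (β ≡ α)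

_⊆F_ : ∀ {n} → Family n → Family n → Set
N ⊆F B = ∀ {β} → N β → B β

record IsBuildingSetP {n} (γ : Subset n) (B : Family n) : Set where
  field
    members : ∀ {β} → B β → Nonempty β × β ⊆ γ
    B1 : ∀ {β δ} → B β → B δ → Nonempty (β ∩ δ) → B (β ∪ δ)
    B2 : ∀ {a} → a ∈ γ → B ⁅ a ⁆

⋃ : ∀ {n} → List (Subset n) → Subset n
⋃ = foldr _∪_ S.⊥

-- An N-antichain: at least two pairwise ⊆-incomparable members of N
-- (pairwise incomparability forces the listed sets to be distinct).
record IsAntichain {n} (N : Family n) (as : List (Subset n)) : Set where
  field
    atLeastTwo : 2 ≤ length as
    inN        : All N as
    incomp     : AllPairs (λ β δ → β ⊈ δ × δ ⊈ β) as

Nested : ∀ {n} → Family n → Family n → Family n → Set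
Nested C B N =
  N ⊆F B × (∀ as → IsAntichain N as → C (⋃ as) × ¬ B (⋃ as))

NestedComplex : ∀ {n} → Family n → Family n → Pred (Family n) _
NestedComplex C B N = Nested C B N

-- N(P(α),B): the link of α in Ñ(P(α),B).
LinkNested : ∀ {n} → Subset n → Family n → Pred (Family n) _
LinkNested α B N =
  NestedComplex (PowerSet α) B N × ¬ N α × NestedComplex (PowerSet α) B (N with+ α)

module Submission where

open import Defs
open import Data.Nat using (ℕ; _≤_; s≤s)
open import Data.Fin using (Fin)
open import Data.Fin.Properties using (any?)
open import Data.Fin.Subset
  using (Subset; _∈_; _∉_; _⊆_; _⊈_; _⊂_; _─_; _-_; ⁅_⁆; inside; outside)
open import Data.Fin.Subset.Properties
  using (_∈?_; ⊆-antisym; p─q⊆p; x∈⁅x⁆; x∈p∧x≢y⇒x∈p-y)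
open import Data.Vec using (_∷_)
open import Data.Vec.Base using (here; there)
open import Data.List using ([]; _∷_; length)
open import Data.List.Relation.Unary.All using (All; []; _∷_)
open import Data.List.Relation.Unary.AllPairs using (AllPairs; _∷_)
open import Data.Product using (_×_; _,_; proj₁; proj₂)
open import Data.Sum using (inj₁; inj₂)
open import Data.Unit using (tt)
open import Data.Empty using (⊥-elim)
open import Relation.Nullary using (¬_; yes; no)
open import Relation.Nullary.Decidable using (_×-dec_; ¬?; decidable-stable)
open import Relation.Binary.PropositionalEquality using (_≢_; refl)
open import Function.Bundles using (_⇔_; mk⇔; module Equivalence)

-- Since α lies in B and contains every member of B, it is comparable with everything and so
-- never occurs in an antichain of N ∪ {α}: nestedness of N ∪ {α} reduces to that of N.
-- A union of an antichain lies in P(α) − B exactly when it lies in (P(α) − {α}) − (B − {α}),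
-- because such a union is in P(α) − {α} precisely when it is a proper subset of α, and α ∈ B.

private
  variable
    n : ℕ
    α β : Subset n
    p q : Subset n
    x : Fin n
    B B′ C C′ M N : Family n

_∖_ : Family n → Family n → Family n
(C ∖ B) γ = C γ × ¬ B γ

x∈p─q⇒x∉q : x ∈ p ─ q → x ∉ q
x∈p─q⇒x∉q {p = inside  ∷ p} {q = outside ∷ q} here              = λ ()
x∈p─q⇒x∉q {p = _       ∷ p} {q = _       ∷ q} (there x∈p─q) (there x∈q) = x∈p─q⇒x∉q x∈p─q x∈q

x∉p-x : x ∉ p - x
x∉p-x {x = x} x∈p-x = x∈p─q⇒x∉q x∈p-x (x∈⁅x⁆ x)

⊆∧≢⇒⊂ : p ⊆ q → p ≢ q → p ⊂ q
⊆∧≢⇒⊂ {p = p} {q = q} p⊆q p≢q with any? (λ x → (x ∈? q) ×-dec ¬? (x ∈? p))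
... | yes missing = p⊆q , missing
... | no ∄missing = ⊥-elim (p≢q (⊆-antisym p⊆q q⊆p))
  where
  q⊆p : q ⊆ p
  q⊆p {x} x∈q = decidable-stable (x ∈? p) (λ x∉p → ∄missing (x , x∈q , x∉p))

⊂⇒≢ : p ⊂ q → p ≢ q
⊂⇒≢ (_ , _ , x∈q , x∉p) refl = x∉p x∈q

PowerSetMinusTop⇔⊂ : PowerSetMinusTop α β ⇔ β ⊂ α
PowerSetMinusTop⇔⊂ {α = α} = mk⇔ to from
  where
  to : PowerSetMinusTop α β → β ⊂ α
  to ((a , a∈α) , β⊆α-a) = (λ x∈β → p─q⊆p α ⁅ a ⁆ (β⊆α-a x∈β)) , a , a∈α , λ a∈β → x∉p-x (β⊆α-a a∈β)
  from : β ⊂ α → PowerSetMinusTop α β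
  from (β⊆α , a , a∈α , a∉β) =
    (a , a∈α) , λ x∈β → x∈p∧x≢y⇒x∈p-y (β⊆α x∈β) (λ { refl → a∉β x∈β })

PowerSet∖B⊆PowerSetMinusTop∖B-α : B α → (PowerSet α ∖ B) ⊆F (PowerSetMinusTop α ∖ (B without α))
PowerSet∖B⊆PowerSetMinusTop∖B-α {B = B} Bα ((tt , β⊆α) , β∉B) =
  Equivalence.from PowerSetMinusTop⇔⊂ (⊆∧≢⇒⊂ β⊆α (λ { refl → β∉B Bα })) ,
  λ (β∈B , _) → β∉B β∈B

PowerSetMinusTop∖B-α⊆PowerSet∖B : (PowerSetMinusTop α ∖ (B without α)) ⊆F (PowerSet α ∖ B)
PowerSetMinusTop∖B-α⊆PowerSet∖B (β∈PminusTop , β∉B-α) =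
  (tt , proj₁ β⊂α) , λ β∈B → β∉B-α (β∈B , ⊂⇒≢ β⊂α)
  where
  β⊂α = Equivalence.to PowerSetMinusTop⇔⊂ β∈PminusTop

Nested-transport : N ⊆F B′ → (C ∖ B) ⊆F (C′ ∖ B′) → Nested C B N → Nested C′ B′ N
Nested-transport N⊆B′ shrink (_ , antichains) = N⊆B′ , λ as ac → shrink (antichains as ac)

module _ (members⊆α : ∀ {β} → M β → β ⊆ α) where

  private
    ⊈⇒≢top : (M with+ α) β → β ⊈ p → p ≢ α
    ⊈⇒≢top (inj₁ β∈M) β⊈α refl = β⊈α (members⊆α β∈M)
    ⊈⇒≢top (inj₂ refl) α⊈α refl = α⊈α (λ x∈α → x∈α)

    drop-top : (M with+ α) β → β ≢ α → M β
    drop-top (inj₁ β∈M) _   = β∈M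
    drop-top (inj₂ β≡α) β≢α = ⊥-elim (β≢α β≡α)

    incomparable-tail : ∀ ys → (M with+ α) β → All (M with+ α) ys →
      All (λ γ → β ⊈ γ × γ ⊈ β) ys → All M ys
    incomparable-tail []       _  []         []             = []
    incomparable-tail (_ ∷ ys) pβ (pγ ∷ pys) ((β⊈γ , _) ∷ rs) =
      drop-top pγ (⊈⇒≢top pβ β⊈γ) ∷ incomparable-tail ys pβ pys rs

  antichain-with+top⇒antichain : ∀ {as} → IsAntichain (M with+ α) as → IsAntichain M as
  antichain-with+top⇒antichain {as = as} ac = record
    { atLeastTwo = atLeastTwo ; inN = allInM as atLeastTwo inN incomp ; incomp = incomp }
    where
    open IsAntichain ac
    allInM : ∀ as → 2 ≤ length as → All (M with+ α) as →
      AllPairs (λ β δ → β ⊈ δ × δ ⊈ β) as → All M as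
    allInM (_ ∷ _ ∷ ys) _ (pβ ∷ pys@(pγ ∷ _)) (rs@((_ , γ⊈β) ∷ _) ∷ _) =
      drop-top pβ (⊈⇒≢top pγ γ⊈β) ∷ incomparable-tail (_ ∷ ys) pβ pys rs
    allInM (_ ∷ []) (s≤s ()) _ _

  Nested-with+top : B α → Nested C B M → Nested C B (M with+ α)
  Nested-with+top Bα (M⊆B , antichains) =
    (λ { (inj₁ β∈M) → M⊆B β∈M ; (inj₂ refl) → Bα }) ,
    λ as ac → antichains as (antichain-with+top⇒antichain ac)

proposition3p4 : ∀ {n} (α : Subset n) (B : Family n) →
    IsBuildingSetP α B → B α →
    ∀ (N : Family n) →
      LinkNested α B N ⇔ NestedComplex (PowerSetMinusTop α) (B without α) N
proposition3p4 α B building Bα N = mk⇔ fromLink toLink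
  where
  open IsBuildingSetP building using (members)

  fromLink : LinkNested α B N → NestedComplex (PowerSetMinusTop α) (B without α) N
  fromLink (nested@(N⊆B , _) , α∉N , _) =
    Nested-transport (λ β∈N → N⊆B β∈N , λ { refl → α∉N β∈N })
                     (PowerSet∖B⊆PowerSetMinusTop∖B-α Bα) nested

  toLink : NestedComplex (PowerSetMinusTop α) (B without α) N → LinkNested α B N
  toLink nested′@(N⊆B-α , _) =
    nested , (λ α∈N → proj₂ (N⊆B-α α∈N) refl) ,
    Nested-with+top (λ β∈N → proj₂ (members (proj₁ (N⊆B-α β∈N)))) {C = PowerSet α} Bα nested
    where
    nested : Nested (PowerSet α) B N
    nested = Nested-transport (λ β∈N → proj₁ (N⊆B-α β∈N)) (PowerSetMinusTop∖B-α⊆PowerSet∖B {B = B}) nested′
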